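{- Let $b > a \geq 1$ be integers with $\gcd(a,b)=1$ and $a+b$ odd, and let $\mathrm{N}_{a,b}(x,y)$ denote the minimal number of moves of the $(a,b)$-knight needed to reach $(x,y)\in\mathbb{Z}^2$ from the origin (as defined in the context). Then there is a constant $C>0$ (independent of $a,b,x,y$) such that for all integers $x \geq y \geq 0$: \begin{enumerate} \item[(i)] if $y \leq \frac{a}{b}\,x$, then $\left|\mathrm{N}_{a,b}(x,y) - \frac{x}{b}\right| \leq C b$; \item[(ii)] if $y > \frac{a}{b}\,x$, then $\left|\mathrm{N}_{a,b}(x,y) - \frac{x+y}{a+b}\right| \leq C b$. \end{enumerate} That is, $\mathrm{N}_{a,b}(x,y) = \frac{x}{b} + O(b)$ in case (i) and $\mathrm{N}_{a,b}(x,y) = \frac{x+y}{a+b} + O(b)$ in case (ii).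
   Context: For a finite set $A\subseteq\mathbb{Z}^2$ and $h\geq 1$, let $hA=\{\mathbf{a}_1+\cdots+\mathbf{a}_h : \mathbf{a}_1,\dots,\mathbf{a}_h\in A\}$ be the $h$-fold sumset. Define $A(0,0):=0$ and, for $(x,y)\neq(0,0)$, $A(x,y):=\min\{h\geq 1 : (x,y)\in hA\}$. For integers $a,b\geq 1$, the $(a,b)$-knight is the set $\mathrm{N}_{a,b}=\{(a,b),(b,a),(-a,b),(-b,a),(-b,-a),(-a,-b),(a,-b),(b,-a)\}$; when $\gcd(a,b)=1$ and $a+b$ is odd, $\mathrm{N}_{a,b}(x,y)$ is finite for every $(x,y)\in\mathbb{Z}^2$. -}

module Defs where

open import Data.Nat using (ℕ; zero; suc; _<_)
open import Data.Integer using (ℤ; +_; -_; _+_)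
open import Data.Product using (_×_; _,_)
open import Relation.Binary.PropositionalEquality using (_≡_)
open import Relation.Nullary using (¬_)

data Knight (a b : ℕ) : ℤ → ℤ → Set where
  k1 : Knight a b (+ a) (+ b)
  k2 : Knight a b (+ b) (+ a)
  k3 : Knight a b (- (+ a)) (+ b)
  k4 : Knight a b (- (+ b)) (+ a)
  k5 : Knight a b (- (+ b)) (- (+ a))
  k6 : Knight a b (- (+ a)) (- (+ b))
  k7 : Knight a b (+ a) (- (+ b))
  k8 : Knight a b (+ b) (- (+ a))

-- InSumset a b h x y : (x,y) is a sum of h elements of N_{a,b}
-- (for h ≥ 1 this is (x,y) ∈ h N_{a,b}; for h = 0 it is the empty sum (0,0)).
data InSumset (a b : ℕ) : ℕ → ℤ → ℤ → Set where
  none : InSumset a b zero (+ 0) (+ 0)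
  step : ∀ {h x y u v} → InSumset a b h x y → Knight a b u v →
         InSumset a b (suc h) (x + u) (y + v)

-- For (x,y) = (0,0) this gives 0;
-- for (x,y) ≠ (0,0) it is min{h ≥ 1 : (x,y) ∈ h N_{a,b}}, since h = 0 only reaches (0,0).
KnightDist : ℕ → ℕ → ℤ → ℤ → ℕ → Set
KnightDist a b x y n = InSumset a b n x y × (∀ m → m < n → ¬ InSumset a b m x y)

{-# OPTIONS --safe #-}
module Submission where

-- Each knight move (u, v) has u ≤ b and u + v ≤ a + b, so a sum of n moves reaching (x, y) has
-- x ≤ n b and x + y ≤ n (a + b): these are the lower bounds. For the upper bounds walk greedily
-- back towards the origin. Below the slope a/b the moves (b, ±a) lower x by b and keep y b ≤ a x;
-- above it the moves (b, a) and (a, b) lower x + y by a + b and keep a x ≤ b y and y ≤ x. The walk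
-- ends in the box [0, 4b)², all of whose points are sums of O(b) moves: as gcd(a, b) = 1, every
-- integer m with |m| = O(b) is i a + j b with 0 ≤ i < b and |j| = O(b), so (2m, 0) = i (2a, 0) +
-- j (2b, 0) with (2a, 0) = (a, b) + (a, -b) and (2b, 0) = (b, a) + (b, -a); as a + b is odd, (a, b)
-- or (b, a) has an odd first and an even second coordinate, which supplies the missing parities.

open import Defs
open import Data.Nat as ℕ using (ℕ; zero; suc; NonZero; _≤_; _<_; _+_; z≤n; s≤s)
import Data.Nat.Properties as ℕP
open import Data.Nat.Coprimality using (Coprime; coprime-Bézout)
open import Data.Nat.Divisibility using (_∣_; divides)
open import Data.Nat.GCD using (module Bézout)
open import Data.Nat.Induction using (<-rec)
open import Data.Nat.Tactic.RingSolver using () renaming (solve-∀ to ℕ-solve-∀; solve to ℕ-solve)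
open import Data.Integer using (ℤ; +_; -[1+_]; -_)
import Data.Integer as ℤ
import Data.Integer.Properties as ℤP
open import Data.Integer.DivMod using (_%ℕ_; _/ℕ_; a≡a%ℕn+[a/ℕn]*n; n%ℕd<d)
open import Data.Integer.Tactic.RingSolver using (solve-∀; solve)
open import Algebra.Properties.CommutativeSemigroup ℤP.+-commutativeSemigroup
  using (xy∙z≈xz∙y; interchange)
open import Algebra.Properties.AbelianGroup ℤP.+-0-abelianGroup using (//-rightDividesˡ; //-rightDividesʳ)
open import Data.Rational using (ℚ; _/_; _-_; _*_; ∣_∣; 0ℚ; toℚᵘ)
  renaming (_≤_ to _≤q_; _<_ to _<q_)
import Data.Rational as ℚ
import Data.Rational.Properties as ℚP
open import Data.Rational.Unnormalised as ℚᵘ using (mkℚᵘ; *≤*; *≡*)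
  renaming (_/_ to _/ᵘ_; _≃_ to _≃ᵘ_)
import Data.Rational.Unnormalised.Properties as ℚᵘP
open import Data.Product using (Σ; ∃; ∃₂; _×_; _,_)
open import Data.Sum using (_⊎_; inj₁; inj₂)
open import Data.List using (List; []; _∷_)
open import Data.List.Relation.Unary.Any using (Any; here; there; any?)
open import Data.List.Membership.Propositional using (_∈_; find; lose)
open import Function using (_∘_)
open import Function.Bundles using (_⇔_; mk⇔; Equivalence)
open import Relation.Nullary using (¬_; Dec; yes; no; contradiction)
open import Relation.Nullary.Decidable using (map′)
open import Relation.Unary using (Decidable)
open import Relation.Binary.PropositionalEquality
  using (_≡_; refl; sym; trans; cong; subst; subst₂; module ≡-Reasoning)

-- Sumsets of knight moves

module _ {a b : ℕ} where

  single : ∀ {u v} → Knight a b u v → InSumset a b 1 u v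
  single {u} {v} k = subst₂ (InSumset a b 1) (ℤP.+-identityˡ u) (ℤP.+-identityˡ v) (step none k)

  infixl 6 _⊕_
  _⊕_ : ∀ {m n x y x′ y′} → InSumset a b m x y → InSumset a b n x′ y′ →
        InSumset a b (m ℕ.+ n) (x ℤ.+ x′) (y ℤ.+ y′)
  _⊕_ {x′ = x′} {y′} none q =
    subst₂ (InSumset a b _) (sym (ℤP.+-identityˡ x′)) (sym (ℤP.+-identityˡ y′)) q
  _⊕_ {x′ = x′} {y′} (step {x = x} {y} {u} {v} p k) q =
    subst₂ (InSumset a b _) (xy∙z≈xz∙y x x′ u) (xy∙z≈xz∙y y y′ v) (step (p ⊕ q) k)

  knight-transpose : ∀ {u v} → Knight a b u v → Knight a b v u
  knight-transpose k1 = k2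
  knight-transpose k2 = k1
  knight-transpose k3 = k8
  knight-transpose k4 = k7
  knight-transpose k5 = k6
  knight-transpose k6 = k5
  knight-transpose k7 = k4
  knight-transpose k8 = k3

  transpose : ∀ {n x y} → InSumset a b n x y → InSumset a b n y x
  transpose none       = none
  transpose (step p k) = step (transpose p) (knight-transpose k)

  knight-negate : ∀ {u v} → Knight a b u v → Knight a b (- u) (- v)
  knight-negate k1 = k6
  knight-negate k2 = k5
  knight-negate k3 = subst (λ u → Knight a b u _) (sym (ℤP.neg-involutive (+ a))) k7
  knight-negate k4 = subst (λ u → Knight a b u _) (sym (ℤP.neg-involutive (+ b))) k8
  knight-negate k5 = subst₂ (Knight a b) (sym (ℤP.neg-involutive (+ b))) (sym (ℤP.neg-involutive (+ a))) k2
  knight-negate k6 = subst₂ (Knight a b) (sym (ℤP.neg-involutive (+ a))) (sym (ℤP.neg-involutive (+ b))) k1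
  knight-negate k7 = subst (Knight a b _) (sym (ℤP.neg-involutive (+ b))) k3
  knight-negate k8 = subst (Knight a b _) (sym (ℤP.neg-involutive (+ a))) k4

  negate : ∀ {n x y} → InSumset a b n x y → InSumset a b n (- x) (- y)
  negate none = none
  negate (step {x = x} {y} {u} {v} p k) =
    subst₂ (InSumset a b _) (sym (ℤP.neg-distrib-+ x u)) (sym (ℤP.neg-distrib-+ y v))
      (step (negate p) (knight-negate k))

  scale : ∀ k {n x y} → InSumset a b n x y → InSumset a b (k ℕ.* n) (+ k ℤ.* x) (+ k ℤ.* y)
  scale zero    {x = x} {y} p = subst₂ (InSumset a b 0) (sym (ℤP.*-zeroˡ x)) (sym (ℤP.*-zeroˡ y)) none
  scale (suc k) {x = x} {y} p =
    subst₂ (InSumset a b _) (sym (ℤP.suc-* (+ k) x)) (sym (ℤP.suc-* (+ k) y)) (p ⊕ scale k p)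

  scaleℤ : ∀ j {n x y} → InSumset a b n x y → InSumset a b (ℤ.∣ j ∣ ℕ.* n) (j ℤ.* x) (j ℤ.* y)
  scaleℤ (+ k)              p = scale k p
  scaleℤ -[1+ k ] {x = x} {y} p =
    subst₂ (InSumset a b _) (scale-negate x) (scale-negate y) (scale (suc k) (negate p))
    where
    scale-negate : ∀ z → + suc k ℤ.* - z ≡ -[1+ k ] ℤ.* z
    scale-negate z = trans (sym (ℤP.neg-distribʳ-* (+ suc k) z)) (ℤP.neg-distribˡ-* (+ suc k) z)

  knightMoves : List (ℤ × ℤ)
  knightMoves = (+ a , + b) ∷ (+ b , + a) ∷ (- + a , + b) ∷ (- + b , + a) ∷
                (- + b , - + a) ∷ (- + a , - + b) ∷ (+ a , - + b) ∷ (+ b , - + a) ∷ []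

  knight⇒∈ : ∀ {u v} → Knight a b u v → (u , v) ∈ knightMoves
  knight⇒∈ k1 = here refl
  knight⇒∈ k2 = there (here refl)
  knight⇒∈ k3 = there (there (here refl))
  knight⇒∈ k4 = there (there (there (here refl)))
  knight⇒∈ k5 = there (there (there (there (here refl))))
  knight⇒∈ k6 = there (there (there (there (there (here refl)))))
  knight⇒∈ k7 = there (there (there (there (there (there (here refl))))))
  knight⇒∈ k8 = there (there (there (there (there (there (there (here refl)))))))

  ∈⇒knight : ∀ {u v} → (u , v) ∈ knightMoves → Knight a b u v
  ∈⇒knight (here refl)                                                          = k1
  ∈⇒knight (there (here refl))                                                  = k2
  ∈⇒knight (there (there (here refl)))                                          = k3
  ∈⇒knight (there (there (there (here refl))))                                  = k4
  ∈⇒knight (there (there (there (there (here refl)))))                          = k5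
  ∈⇒knight (there (there (there (there (there (here refl))))))                  = k6
  ∈⇒knight (there (there (there (there (there (there (here refl)))))))          = k7
  ∈⇒knight (there (there (there (there (there (there (there (here refl)))))))) = k8

  inSumset? : ∀ n x y → Dec (InSumset a b n x y)
  inSumset? zero x y with x ℤ.≟ + 0 | y ℤ.≟ + 0
  ... | yes refl | yes refl = yes none
  ... | no x≢0   | _        = no λ { none → x≢0 refl }
  ... | yes _    | no y≢0   = no λ { none → y≢0 refl }
  inSumset? (suc n) x y =
    map′ fromLastMove toLastMove (any? (λ (u , v) → inSumset? n (x ℤ.- u) (y ℤ.- v)) knightMoves)
    where
    LastMove : ℤ × ℤ → Set
    LastMove (u , v) = InSumset a b n (x ℤ.- u) (y ℤ.- v)

    fromLastMove : Any LastMove knightMoves → InSumset a b (suc n) x y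
    fromLastMove last with find last
    ... | (u , v) , uv∈ , p =
      subst₂ (InSumset a b _) (//-rightDividesˡ u x) (//-rightDividesˡ v y) (step p (∈⇒knight uv∈))

    toLastMove : InSumset a b (suc n) x y → Any LastMove knightMoves
    toLastMove (step {x = x′} {y′} {u} {v} p k) =
      lose (knight⇒∈ k)
        (subst₂ (InSumset a b n) (sym (//-rightDividesʳ u x′)) (sym (//-rightDividesʳ v y′)) p)

Within : ℕ → ℕ → ℕ → ℤ → ℤ → Set
Within a b B x y = ∃ λ n → n ≤ B × InSumset a b n x y

module _ {a b : ℕ} where

  infixl 6 _⊕ʷ_
  _⊕ʷ_ : ∀ {B B′ x y x′ y′} → Within a b B x y → Within a b B′ x′ y′ →
         Within a b (B ℕ.+ B′) (x ℤ.+ x′) (y ℤ.+ y′)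
  (m , m≤B , p) ⊕ʷ (n , n≤B′ , q) = m ℕ.+ n , ℕP.+-mono-≤ m≤B n≤B′ , p ⊕ q

  transposeʷ : ∀ {B x y} → Within a b B x y → Within a b B y x
  transposeʷ (n , n≤B , p) = n , n≤B , transpose p

  weakenʷ : ∀ {B B′ x y} → B ≤ B′ → Within a b B x y → Within a b B′ x y
  weakenʷ B≤B′ (n , n≤B , p) = n , ℕP.≤-trans n≤B B≤B′ , p

-- Lower bounds

module _ {a b : ℕ} (f : ℤ → ℤ → ℤ) (c : ℕ)
         (f-0 : f (+ 0) (+ 0) ≡ + 0)
         (f-additive : ∀ x y u v → f (x ℤ.+ u) (y ℤ.+ v) ≡ f x y ℤ.+ f u v)
         (f-knight : ∀ {u v} → Knight a b u v → f u v ℤ.≤ + c) where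

  sumset-functional-≤ : ∀ {n x y} → InSumset a b n x y → f x y ℤ.≤ + (n ℕ.* c)
  sumset-functional-≤ none = ℤP.≤-reflexive f-0
  sumset-functional-≤ {suc n} (step {x = x} {y} {u} {v} p k) = begin
    f (x ℤ.+ u) (y ℤ.+ v)   ≡⟨ f-additive x y u v ⟩
    f x y ℤ.+ f u v         ≤⟨ ℤP.+-mono-≤ (sumset-functional-≤ p) (f-knight k) ⟩
    + (n ℕ.* c ℕ.+ c)       ≡⟨ cong +_ (ℕP.+-comm (n ℕ.* c) c) ⟩
    + (suc n ℕ.* c)         ∎
    where open ℤP.≤-Reasoning

module _ {a b : ℕ} (a≤b : a ≤ b) where

  knight-x≤b : ∀ {u v} → Knight a b u v → u ℤ.≤ + b
  knight-x≤b k1 = ℤ.+≤+ a≤b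
  knight-x≤b k2 = ℤP.≤-refl
  knight-x≤b k3 = ℤP.neg-≤-pos
  knight-x≤b k4 = ℤP.neg-≤-pos
  knight-x≤b k5 = ℤP.neg-≤-pos
  knight-x≤b k6 = ℤP.neg-≤-pos
  knight-x≤b k7 = ℤ.+≤+ a≤b
  knight-x≤b k8 = ℤP.≤-refl

  knight-x+y≤a+b : ∀ {u v} → Knight a b u v → u ℤ.+ v ℤ.≤ + (a ℕ.+ b)
  knight-x+y≤a+b k1 = ℤP.≤-refl
  knight-x+y≤a+b k2 = ℤP.≤-reflexive (cong +_ (ℕP.+-comm b a))
  knight-x+y≤a+b k3 = ℤP.+-monoˡ-≤ (+ b) (ℤP.neg-≤-pos {a})
  knight-x+y≤a+b k4 = ℤP.≤-trans (ℤP.+-monoˡ-≤ (+ a) (ℤP.neg-≤-pos {b})) (knight-x+y≤a+b k2)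
  knight-x+y≤a+b k5 =
    ℤP.≤-trans (ℤP.+-mono-≤ {y = + b} {v = + a} (ℤP.neg-≤-pos {b}) (ℤP.neg-≤-pos {a}))
               (knight-x+y≤a+b k2)
  knight-x+y≤a+b k6 = ℤP.+-mono-≤ {y = + a} {v = + b} (ℤP.neg-≤-pos {a}) (ℤP.neg-≤-pos {b})
  knight-x+y≤a+b k7 = ℤP.+-monoʳ-≤ (+ a) (ℤP.neg-≤-pos {b})
  knight-x+y≤a+b k8 = ℤP.≤-trans (ℤP.+-monoʳ-≤ (+ b) (ℤP.neg-≤-pos {a})) (knight-x+y≤a+b k2)

  sumset-x≤n*b : ∀ {n x y} → InSumset a b n x y → x ℤ.≤ + (n ℕ.* b)
  sumset-x≤n*b = sumset-functional-≤ (λ x _ → x) b refl (λ _ _ _ _ → refl) knight-x≤b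

  sumset-x+y≤n*[a+b] : ∀ {n x y} → InSumset a b n x y → x ℤ.+ y ℤ.≤ + (n ℕ.* (a ℕ.+ b))
  sumset-x+y≤n*[a+b] =
    sumset-functional-≤ (λ x y → x ℤ.+ y) (a ℕ.+ b) refl (λ x y u v → interchange x u y v)
                        knight-x+y≤a+b

-- Bézout

private
  lift-identity : ∀ m n p q → 1 ℕ.+ m ℕ.* n ≡ p ℕ.* q → + 1 ℤ.+ + m ℤ.* + n ≡ + p ℤ.* + q
  lift-identity m n p q eq =
    trans (cong (λ z → + 1 ℤ.+ z) (sym (ℤP.pos-* m n))) (trans (cong +_ eq) (ℤP.pos-* p q))

  negate-identity : ∀ s a t b → + 1 ℤ.+ s ℤ.* a ≡ t ℤ.* b → - s ℤ.* a ≡ + 1 ℤ.+ - t ℤ.* b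
  negate-identity s a t b eq = begin
    - s ℤ.* a                   ≡⟨ solve (s ∷ a ∷ []) ⟩
    + 1 ℤ.- (+ 1 ℤ.+ s ℤ.* a)   ≡⟨ cong (λ z → + 1 ℤ.- z) eq ⟩
    + 1 ℤ.- t ℤ.* b             ≡⟨ solve (t ∷ b ∷ []) ⟩
    + 1 ℤ.+ - t ℤ.* b           ∎
    where open ≡-Reasoning

  recombine : ∀ m s t a b i q → s ℤ.* a ≡ + 1 ℤ.+ t ℤ.* b → m ℤ.* s ≡ i ℤ.+ q ℤ.* b →
              m ≡ i ℤ.* a ℤ.+ (q ℤ.* a ℤ.- m ℤ.* t) ℤ.* b
  recombine m s t a b i q sa≡1+tb ms≡i+qb = begin
    m
      ≡⟨ solve (m ∷ t ∷ b ∷ []) ⟩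
    m ℤ.* (+ 1 ℤ.+ t ℤ.* b) ℤ.- m ℤ.* t ℤ.* b
      ≡⟨ cong (λ z → m ℤ.* z ℤ.- m ℤ.* t ℤ.* b) (sym sa≡1+tb) ⟩
    m ℤ.* (s ℤ.* a) ℤ.- m ℤ.* t ℤ.* b
      ≡⟨ cong (ℤ._- m ℤ.* t ℤ.* b) (sym (ℤP.*-assoc m s a)) ⟩
    m ℤ.* s ℤ.* a ℤ.- m ℤ.* t ℤ.* b
      ≡⟨ cong (λ z → z ℤ.* a ℤ.- m ℤ.* t ℤ.* b) ms≡i+qb ⟩
    (i ℤ.+ q ℤ.* b) ℤ.* a ℤ.- m ℤ.* t ℤ.* b
      ≡⟨ solve (i ∷ q ∷ a ∷ m ∷ t ∷ b ∷ []) ⟩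
    i ℤ.* a ℤ.+ (q ℤ.* a ℤ.- m ℤ.* t) ℤ.* b
      ∎
    where open ≡-Reasoning

module _ {a b : ℕ} (coprime : Coprime a b) where

  inverse-mod : ∃₂ λ s t → s ℤ.* + a ≡ + 1 ℤ.+ t ℤ.* + b
  inverse-mod with coprime-Bézout coprime
  ... | Bézout.+- x y eq = + x , + y , sym (lift-identity y b x a eq)
  ... | Bézout.-+ x y eq = - + x , - + y , negate-identity (+ x) (+ a) (+ y) (+ b) (lift-identity x a y b eq)

  decomposition : .{{_ : NonZero b}} → ∀ m →
                  ∃₂ λ i j → i < b × m ≡ + i ℤ.* + a ℤ.+ j ℤ.* + b
  decomposition m with inverse-mod
  ... | s , t , sa≡1+tb =
    (m ℤ.* s) %ℕ b , (m ℤ.* s) /ℕ b ℤ.* + a ℤ.- m ℤ.* t , n%ℕd<d (m ℤ.* s) b ,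
    recombine m s t (+ a) (+ b) (+ ((m ℤ.* s) %ℕ b)) ((m ℤ.* s) /ℕ b) sa≡1+tb
              (a≡a%ℕn+[a/ℕn]*n (m ℤ.* s) b)

-- The box [0, 4b)²

data Parity : ℕ → Set where
  even : ∀ h → Parity (h ℕ.+ h)
  odd  : ∀ h → Parity (suc (h ℕ.+ h))

parity : ∀ n → Parity n
parity zero = even 0
parity (suc n) with parity n
... | even h = odd h
... | odd h  = subst Parity (cong suc (ℕP.+-suc h h)) (even (suc h))

odd-knight-move : ∀ {a b} → a ≤ b → ¬ 2 ∣ a ℕ.+ b →
                  ∃₂ λ p q → p ≤ b × q ≤ b × Knight a b (+ suc (p ℕ.+ p)) (+ (q ℕ.+ q))
odd-knight-move {a} {b} a≤b a+b-odd with parity a | parity b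
... | even h | even g = contradiction (divides (h ℕ.+ g) (even+even h g)) a+b-odd
  where
  even+even : ∀ h g → h ℕ.+ h ℕ.+ (g ℕ.+ g) ≡ (h ℕ.+ g) ℕ.* 2
  even+even = ℕ-solve-∀
... | odd h  | odd g  = contradiction (divides (suc (h ℕ.+ g)) (odd+odd h g)) a+b-odd
  where
  odd+odd : ∀ h g → suc (h ℕ.+ h) ℕ.+ suc (g ℕ.+ g) ≡ suc (h ℕ.+ g) ℕ.* 2
  odd+odd = ℕ-solve-∀
... | odd h  | even g =
  h , g , ℕP.≤-trans (ℕP.m≤m+n h h) (ℕP.≤-trans (ℕP.n≤1+n _) a≤b) , ℕP.m≤m+n g g , k1
... | even h | odd g  =
  g , h , ℕP.≤-trans (ℕP.m≤m+n g g) (ℕP.n≤1+n _) , ℕP.≤-trans (ℕP.m≤m+n h h) a≤b , k2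

half-≤ : ∀ {h} b → h ℕ.+ h ≤ 4 ℕ.* b → h ≤ 2 ℕ.* b
half-≤ {h} b h+h≤4b = ℕP.*-cancelˡ-≤ 2 (subst₂ _≤_ h+h≡2h 4b≡2[2b] h+h≤4b)
  where
  h+h≡2h : h ℕ.+ h ≡ 2 ℕ.* h
  h+h≡2h = ℕ-solve (h ∷ [])
  4b≡2[2b] : 4 ℕ.* b ≡ 2 ℕ.* (2 ℕ.* b)
  4b≡2[2b] = ℕ-solve (b ∷ [])

private
  double-combination : ∀ i a j b →
    i ℤ.* (a ℤ.+ a) ℤ.+ j ℤ.* (b ℤ.+ b) ≡ (i ℤ.* a ℤ.+ j ℤ.* b) ℤ.+ (i ℤ.* a ℤ.+ j ℤ.* b)
  double-combination = solve-∀

  cancelling-combination : ∀ i b j a → i ℤ.* (b ℤ.- b) ℤ.+ j ℤ.* (a ℤ.- a) ≡ + 0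
  cancelling-combination = solve-∀

  isolate-right : ∀ i a j b → j ℤ.* b ≡ (i ℤ.* a ℤ.+ j ℤ.* b) ℤ.- i ℤ.* a
  isolate-right = solve-∀

  odd-offset : ∀ p h → + 1 ℤ.+ (p ℤ.+ p) ℤ.+ ((h ℤ.- p) ℤ.+ (h ℤ.- p)) ≡ + 1 ℤ.+ (h ℤ.+ h)
  odd-offset = solve-∀

  even-offset : ∀ q → q ℤ.+ q ℤ.+ (- q ℤ.+ - q) ≡ + 0
  even-offset = solve-∀

module _ {a b : ℕ} .{{_ : NonZero b}} (a≤b : a ≤ b) (coprime : Coprime a b) where

  horizontal-combination : ∀ {m} i j → i < b → m ≡ + i ℤ.* + a ℤ.+ j ℤ.* + b →
                           ℤ.∣ m ∣ ≤ 3 ℕ.* b → Within a b (10 ℕ.* b) (m ℤ.+ m) (+ 0)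
  horizontal-combination {m} i j i<b m≡ia+jb ∣m∣≤3b =
    i ℕ.* 2 ℕ.+ ℤ.∣ j ∣ ℕ.* 2 , moves≤10b ,
    subst₂ (InSumset a b _) x≡2m (cancelling-combination (+ i) (+ b) j (+ a))
      (scale i (single k1 ⊕ single k7) ⊕ scaleℤ j (single k2 ⊕ single k8))
    where
    open ℕP.≤-Reasoning

    x≡2m : + i ℤ.* (+ a ℤ.+ + a) ℤ.+ j ℤ.* (+ b ℤ.+ + b) ≡ m ℤ.+ m
    x≡2m = trans (double-combination (+ i) (+ a) j (+ b)) (cong (λ z → z ℤ.+ z) (sym m≡ia+jb))

    jb≡m-ia : j ℤ.* + b ≡ m ℤ.- + i ℤ.* + a
    jb≡m-ia = trans (isolate-right (+ i) (+ a) j (+ b)) (cong (ℤ._- + i ℤ.* + a) (sym m≡ia+jb))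

    ∣j∣≤3+a : ℤ.∣ j ∣ ≤ 3 ℕ.+ a
    ∣j∣≤3+a = ℕP.*-cancelʳ-≤ ℤ.∣ j ∣ (3 ℕ.+ a) b (begin
      ℤ.∣ j ∣ ℕ.* b                   ≡⟨ ℤP.abs-* j (+ b) ⟨
      ℤ.∣ j ℤ.* + b ∣                 ≡⟨ cong ℤ.∣_∣ jb≡m-ia ⟩
      ℤ.∣ m ℤ.- + i ℤ.* + a ∣         ≤⟨ ℤP.∣i-j∣≤∣i∣+∣j∣ m (+ i ℤ.* + a) ⟩
      ℤ.∣ m ∣ ℕ.+ ℤ.∣ + i ℤ.* + a ∣   ≡⟨ cong (ℤ.∣ m ∣ ℕ.+_) (ℤP.abs-* (+ i) (+ a)) ⟩
      ℤ.∣ m ∣ ℕ.+ i ℕ.* a             ≤⟨ ℕP.+-mono-≤ ∣m∣≤3b (ℕP.*-monoˡ-≤ a (ℕP.<⇒≤ i<b)) ⟩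
      3 ℕ.* b ℕ.+ b ℕ.* a             ≡⟨ ℕ-solve (a ∷ b ∷ []) ⟩
      (3 ℕ.+ a) ℕ.* b                 ∎)

    moves≤10b : i ℕ.* 2 ℕ.+ ℤ.∣ j ∣ ℕ.* 2 ≤ 10 ℕ.* b
    moves≤10b = begin
      i ℕ.* 2 ℕ.+ ℤ.∣ j ∣ ℕ.* 2          ≤⟨ ℕP.+-mono-≤ (ℕP.*-monoˡ-≤ 2 (ℕP.<⇒≤ i<b)) (ℕP.*-monoˡ-≤ 2 ∣j∣≤3+a) ⟩
      b ℕ.* 2 ℕ.+ (3 ℕ.+ a) ℕ.* 2        ≤⟨ ℕP.+-monoʳ-≤ (b ℕ.* 2) (ℕP.*-monoˡ-≤ 2 3+a≤3b+b) ⟩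
      b ℕ.* 2 ℕ.+ (3 ℕ.* b ℕ.+ b) ℕ.* 2  ≡⟨ ℕ-solve (b ∷ []) ⟩
      10 ℕ.* b                           ∎
      where
      3+a≤3b+b : 3 ℕ.+ a ≤ 3 ℕ.* b ℕ.+ b
      3+a≤3b+b = ℕP.+-mono-≤ (ℕP.*-monoʳ-≤ 3 (ℕ.>-nonZero⁻¹ b)) a≤b

  -- Destructured by let: a with-abstraction over the decomposition exhausts memory when type checking.
  horizontal : ∀ m → ℤ.∣ m ∣ ≤ 3 ℕ.* b → Within a b (10 ℕ.* b) (m ℤ.+ m) (+ 0)
  horizontal m =
    let i , j , i<b , m≡ia+jb = decomposition coprime m in horizontal-combination i j i<b m≡ia+jb

  even-point : ∀ m m′ → ℤ.∣ m ∣ ≤ 3 ℕ.* b → ℤ.∣ m′ ∣ ≤ 3 ℕ.* b →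
               Within a b (20 ℕ.* b) (m ℤ.+ m) (m′ ℤ.+ m′)
  even-point m m′ ∣m∣≤3b ∣m′∣≤3b =
    weakenʷ (ℕP.≤-reflexive (sym (ℕP.*-distribʳ-+ b 10 10)))
      (subst₂ (Within a b _) (ℤP.+-identityʳ (m ℤ.+ m)) (ℤP.+-identityˡ (m′ ℤ.+ m′))
        (horizontal m ∣m∣≤3b ⊕ʷ transposeʷ (horizontal m′ ∣m′∣≤3b)))

  module _ (a+b-odd : ¬ 2 ∣ a ℕ.+ b) where

    axis : ∀ X → X < 4 ℕ.* b → Within a b (21 ℕ.* b) (+ X) (+ 0)
    axis X X<4b with parity X | odd-knight-move a≤b a+b-odd
    ... | even h | _ =
      weakenʷ (ℕP.*-monoˡ-≤ b (ℕP.m≤m+n 10 11))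
        (horizontal (+ h) (ℕP.≤-trans (half-≤ b (ℕP.<⇒≤ X<4b)) (ℕP.m≤n+m (2 ℕ.* b) b)))
    ... | odd h  | p , q , p≤b , q≤b , k =
      weakenʷ (ℕP.+-monoˡ-≤ (20 ℕ.* b) (ℕ.>-nonZero⁻¹ b))
        (subst₂ (Within a b _) (odd-offset (+ p) (+ h)) (even-offset (+ q))
          ((1 , ℕP.≤-refl , single k) ⊕ʷ even-point (+ h ℤ.- + p) (- + q) ∣h-p∣≤3b ∣-q∣≤3b))
      where
      open ℕP.≤-Reasoning

      ∣h-p∣≤3b : ℤ.∣ + h ℤ.- + p ∣ ≤ 3 ℕ.* b
      ∣h-p∣≤3b = begin
        ℤ.∣ + h ℤ.- + p ∣   ≤⟨ ℤP.∣i-j∣≤∣i∣+∣j∣ (+ h) (+ p) ⟩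
        h ℕ.+ p             ≤⟨ ℕP.+-mono-≤ (half-≤ b (ℕP.≤-trans (ℕP.n≤1+n _) (ℕP.<⇒≤ X<4b))) p≤b ⟩
        2 ℕ.* b ℕ.+ b       ≡⟨ ℕP.+-comm (2 ℕ.* b) b ⟩
        3 ℕ.* b             ∎

      ∣-q∣≤3b : ℤ.∣ - + q ∣ ≤ 3 ℕ.* b
      ∣-q∣≤3b = begin
        ℤ.∣ - + q ∣   ≡⟨ ℤP.∣-i∣≡∣i∣ (+ q) ⟩
        q             ≤⟨ q≤b ⟩
        b             ≤⟨ ℕP.m≤m+n b (2 ℕ.* b) ⟩
        3 ℕ.* b       ∎

    box : ∀ X Y → X < 4 ℕ.* b → Y < 4 ℕ.* b → Within a b (42 ℕ.* b) (+ X) (+ Y)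
    box X Y X<4b Y<4b =
      weakenʷ (ℕP.≤-reflexive (sym (ℕP.*-distribʳ-+ b 21 21)))
        (subst₂ (Within a b _) (ℤP.+-identityʳ (+ X)) (ℤP.+-identityˡ (+ Y))
          (axis X X<4b ⊕ʷ transposeʷ (axis Y Y<4b)))

-- Greedy descent

record StepBack (a b : ℕ) (P : ℕ → ℕ → Set) (φ : ℕ → ℕ → ℕ) (w X Y : ℕ) : Set where
  field
    X′ Y′     : ℕ
    invariant : P X′ Y′
    potential : φ X Y ≡ φ X′ Y′ ℕ.+ w
    extend    : ∀ {n} → InSumset a b n (+ X′) (+ Y′) → InSumset a b (suc n) (+ X) (+ Y)

module _ {a b : ℕ} (B w : ℕ) .{{_ : NonZero w}} (P : ℕ → ℕ → Set) (φ : ℕ → ℕ → ℕ) where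

  Descent : ℕ → ℕ → Set
  Descent X Y = ∃ λ n → InSumset a b n (+ X) (+ Y) × n ℕ.* w ≤ φ X Y ℕ.+ B ℕ.* w

  stop-descent : ∀ {X Y} → Within a b B (+ X) (+ Y) → Descent X Y
  stop-descent {X} {Y} (n , n≤B , p) =
    n , p , ℕP.≤-trans (ℕP.*-monoˡ-≤ w n≤B) (ℕP.m≤n+m (B ℕ.* w) (φ X Y))

  module _ {X Y : ℕ} (back : StepBack a b P φ w X Y) where
    open StepBack back

    potential-decreases : φ X′ Y′ < φ X Y
    potential-decreases =
      subst (φ X′ Y′ <_) (sym potential) (ℕP.m<m+n (φ X′ Y′) (ℕ.>-nonZero⁻¹ w))

    extend-descent : Descent X′ Y′ → Descent X Y
    extend-descent (n , p , nw≤φ′+Bw) = suc n , extend p , (begin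
      w ℕ.+ n ℕ.* w                ≤⟨ ℕP.+-monoʳ-≤ w nw≤φ′+Bw ⟩
      w ℕ.+ (φ X′ Y′ ℕ.+ B ℕ.* w)  ≡⟨ ℕP.+-assoc w (φ X′ Y′) (B ℕ.* w) ⟨
      w ℕ.+ φ X′ Y′ ℕ.+ B ℕ.* w    ≡⟨ cong (ℕ._+ B ℕ.* w) (ℕP.+-comm w (φ X′ Y′)) ⟩
      φ X′ Y′ ℕ.+ w ℕ.+ B ℕ.* w    ≡⟨ cong (ℕ._+ B ℕ.* w) potential ⟨
      φ X Y ℕ.+ B ℕ.* w            ∎)
      where open ℕP.≤-Reasoning

  descend : (∀ {X Y} → P X Y → Within a b B (+ X) (+ Y) ⊎ StepBack a b P φ w X Y) →
            ∀ X Y → P X Y → Descent X Y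
  descend stop-or-step X Y = <-rec Goal go (φ X Y) X Y refl
    where
    Goal : ℕ → Set
    Goal k = ∀ X Y → φ X Y ≡ k → P X Y → Descent X Y

    go : ∀ k → (∀ {k′} → k′ < k → Goal k′) → Goal k
    go _ rec X Y refl inv with stop-or-step inv
    ... | inj₁ within = stop-descent within
    ... | inj₂ back   =
      extend-descent back (rec (potential-decreases back) _ _ refl (StepBack.invariant back))

m≤n⇒∃[o]o+m≡n : ∀ {m n} → m ≤ n → ∃ λ o → o ℕ.+ m ≡ n
m≤n⇒∃[o]o+m≡n {m} m≤n with ℕP.m≤n⇒∃[o]m+o≡n m≤n
... | o , m+o≡n = o , trans (ℕP.+-comm o m) m+o≡n

split-off-b : ∀ b {X} → 4 ℕ.* b ≤ X → ∃ λ X′ → X′ ℕ.+ b ≡ X × 3 ℕ.* b ≤ X′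
split-off-b b 4b≤X with ℕP.m≤n⇒∃[o]m+o≡n 4b≤X
... | o , 4b+o≡X = 3 ℕ.* b ℕ.+ o , trans (rearrange b o) 4b+o≡X , ℕP.m≤m+n (3 ℕ.* b) o
  where
  rearrange : ∀ b o → 3 ℕ.* b ℕ.+ o ℕ.+ b ≡ 4 ℕ.* b ℕ.+ o
  rearrange = ℕ-solve-∀

cross-≤ : ∀ a d X Y → X ℕ.+ a ℕ.+ a ≤ Y ℕ.+ (d ℕ.+ a) ℕ.+ (d ℕ.+ a) → a ℕ.+ a ≤ Y →
          a ℕ.* X ≤ (d ℕ.+ a) ℕ.* Y
cross-≤ a d X Y X+2a≤Y+2[d+a] 2a≤Y = begin
  a ℕ.* X                       ≤⟨ ℕP.*-monoʳ-≤ a X≤Y+2d ⟩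
  a ℕ.* (Y ℕ.+ d ℕ.+ d)         ≡⟨ ℕ-solve (a ∷ d ∷ Y ∷ []) ⟩
  a ℕ.* Y ℕ.+ d ℕ.* (a ℕ.+ a)   ≤⟨ ℕP.+-monoʳ-≤ (a ℕ.* Y) (ℕP.*-monoʳ-≤ d 2a≤Y) ⟩
  a ℕ.* Y ℕ.+ d ℕ.* Y           ≡⟨ ℕ-solve (a ∷ d ∷ Y ∷ []) ⟩
  (d ℕ.+ a) ℕ.* Y               ∎
  where
  open ℕP.≤-Reasoning
  X≤Y+2d : X ≤ Y ℕ.+ d ℕ.+ d
  X≤Y+2d = ℕP.+-cancelʳ-≤ (a ℕ.+ a) X (Y ℕ.+ d ℕ.+ d) (begin
    X ℕ.+ (a ℕ.+ a)                 ≡⟨ ℕP.+-assoc X a a ⟨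
    X ℕ.+ a ℕ.+ a                   ≤⟨ X+2a≤Y+2[d+a] ⟩
    Y ℕ.+ (d ℕ.+ a) ℕ.+ (d ℕ.+ a)   ≡⟨ ℕ-solve (Y ∷ d ∷ a ∷ []) ⟩
    Y ℕ.+ d ℕ.+ d ℕ.+ (a ℕ.+ a)     ∎)

module _ {a b : ℕ} .{{_ : NonZero b}} (a≤b : a ≤ b) where

  open ℕP.≤-Reasoning

  below-slope⇒≤ : ∀ {X Y} → Y ℕ.* b ≤ a ℕ.* X → Y ≤ X
  below-slope⇒≤ {X} {Y} Yb≤aX = ℕP.*-cancelʳ-≤ Y X b (begin
    Y ℕ.* b   ≤⟨ Yb≤aX ⟩
    a ℕ.* X   ≤⟨ ℕP.*-monoˡ-≤ X a≤b ⟩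
    b ℕ.* X   ≡⟨ ℕP.*-comm b X ⟩
    X ℕ.* b   ∎)

  below-slope-shift : ∀ X Y → (Y ℕ.+ a) ℕ.* b ≤ a ℕ.* (X ℕ.+ b) → Y ℕ.* b ≤ a ℕ.* X
  below-slope-shift X Y le = ℕP.+-cancelʳ-≤ (a ℕ.* b) (Y ℕ.* b) (a ℕ.* X) (begin
    Y ℕ.* b ℕ.+ a ℕ.* b   ≡⟨ ℕP.*-distribʳ-+ b Y a ⟨
    (Y ℕ.+ a) ℕ.* b       ≤⟨ le ⟩
    a ℕ.* (X ℕ.+ b)       ≡⟨ ℕP.*-distribˡ-+ a X b ⟩
    a ℕ.* X ℕ.+ a ℕ.* b   ∎)

  below-slope-bounce : ∀ {X Y} → Y < a → 2 ℕ.* b ≤ X → (Y ℕ.+ a) ℕ.* b ≤ a ℕ.* X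
  below-slope-bounce {X} {Y} Y<a 2b≤X = begin
    (Y ℕ.+ a) ℕ.* b   ≤⟨ ℕP.*-monoˡ-≤ b (ℕP.+-monoˡ-≤ a (ℕP.<⇒≤ Y<a)) ⟩
    (a ℕ.+ a) ℕ.* b   ≡⟨ ℕ-solve (a ∷ b ∷ []) ⟩
    a ℕ.* (2 ℕ.* b)   ≤⟨ ℕP.*-monoʳ-≤ a 2b≤X ⟩
    a ℕ.* X           ∎

  above-slope-shift : ∀ X Y → a ℕ.* (X ℕ.+ b) ≤ b ℕ.* (Y ℕ.+ a) → a ℕ.* X ≤ b ℕ.* Y
  above-slope-shift X Y le = ℕP.+-cancelʳ-≤ (a ℕ.* b) (a ℕ.* X) (b ℕ.* Y) (begin
    a ℕ.* X ℕ.+ a ℕ.* b   ≡⟨ ℕP.*-distribˡ-+ a X b ⟨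
    a ℕ.* (X ℕ.+ b)       ≤⟨ le ⟩
    b ℕ.* (Y ℕ.+ a)       ≡⟨ ℕP.*-distribˡ-+ b Y a ⟩
    b ℕ.* Y ℕ.+ b ℕ.* a   ≡⟨ cong (b ℕ.* Y ℕ.+_) (ℕP.*-comm b a) ⟩
    b ℕ.* Y ℕ.+ a ℕ.* b   ∎)

  above-slope⇒a≤Y : ∀ {X Y} → a ℕ.* X ≤ b ℕ.* Y → b ≤ X → a ≤ Y
  above-slope⇒a≤Y {X} {Y} aX≤bY b≤X = ℕP.≮⇒≥ λ Y<a → ℕP.<-irrefl refl (begin-strict
    b ℕ.* Y   <⟨ ℕP.*-monoʳ-< b Y<a ⟩
    b ℕ.* a   ≡⟨ ℕP.*-comm b a ⟩
    a ℕ.* b   ≤⟨ ℕP.*-monoʳ-≤ a b≤X ⟩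
    a ℕ.* X   ≤⟨ aX≤bY ⟩
    b ℕ.* Y   ∎)

  above-slope-cross : ∀ X Y → X ℕ.+ a ℕ.+ a ≤ Y ℕ.+ b ℕ.+ b → a ℕ.+ a ≤ Y → a ℕ.* X ≤ b ℕ.* Y
  above-slope-cross X Y with m≤n⇒∃[o]o+m≡n a≤b
  ... | d , d+a≡b = subst (λ b → X ℕ.+ a ℕ.+ a ≤ Y ℕ.+ b ℕ.+ b → a ℕ.+ a ≤ Y → a ℕ.* X ≤ b ℕ.* Y)
                          d+a≡b (cross-≤ a d X Y)

  above-slope⇒b≤Y : ∀ {X Y} → 4 ℕ.* b ≤ X → X ℕ.+ a < Y ℕ.+ b → b ≤ Y
  above-slope⇒b≤Y {X} {Y} 4b≤X X+a<Y+b = ℕP.+-cancelʳ-≤ b b Y (begin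
    b ℕ.+ b    ≤⟨ ℕP.m≤m+n (b ℕ.+ b) (2 ℕ.* b) ⟩
    b ℕ.+ b ℕ.+ 2 ℕ.* b   ≡⟨ ℕ-solve (b ∷ []) ⟩
    4 ℕ.* b    ≤⟨ 4b≤X ⟩
    X          ≤⟨ ℕP.m≤m+n X a ⟩
    X ℕ.+ a    ≤⟨ ℕP.<⇒≤ X+a<Y+b ⟩
    Y ℕ.+ b    ∎)

module _ {a b : ℕ} .{{_ : NonZero b}}
         (a≤b : a ≤ b) (coprime : Coprime a b) (a+b-odd : ¬ 2 ∣ a ℕ.+ b) where

  BelowSlope : ℕ → ℕ → Set
  BelowSlope X Y = Y ℕ.* b ≤ a ℕ.* X

  below-slope-step-back : ∀ X′ Y → 3 ℕ.* b ≤ X′ → BelowSlope (X′ ℕ.+ b) Y →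
                          StepBack a b BelowSlope (λ X _ → X) b (X′ ℕ.+ b) Y
  below-slope-step-back X′ Y 3b≤X′ Yb≤aX with a ℕ.≤? Y
  ... | yes a≤Y with m≤n⇒∃[o]o+m≡n a≤Y
  ...   | Y′ , refl = record
    { X′ = X′ ; Y′ = Y′
    ; invariant = below-slope-shift a≤b X′ Y′ Yb≤aX
    ; potential = refl
    ; extend = λ p → step p k2
    }
  below-slope-step-back X′ Y 3b≤X′ _ | no a≰Y = record
    { X′ = X′ ; Y′ = Y ℕ.+ a
    ; invariant = below-slope-bounce a≤b (ℕP.≰⇒> a≰Y) (ℕP.≤-trans (ℕP.m≤n+m (2 ℕ.* b) b) 3b≤X′)
    ; potential = refl
    ; extend = λ p → subst (InSumset a b _ _) (//-rightDividesʳ (+ a) (+ Y)) (step p k8)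
    }

  below-slope-stop-or-step : ∀ {X Y} → BelowSlope X Y →
    Within a b (42 ℕ.* b) (+ X) (+ Y) ⊎ StepBack a b BelowSlope (λ X _ → X) b X Y
  below-slope-stop-or-step {X} {Y} Yb≤aX with X ℕ.<? 4 ℕ.* b
  ... | yes X<4b =
    inj₁ (box a≤b coprime a+b-odd X Y X<4b (ℕP.≤-<-trans (below-slope⇒≤ a≤b Yb≤aX) X<4b))
  ... | no X≮4b with split-off-b b (ℕP.≮⇒≥ X≮4b)
  ...   | X′ , refl , 3b≤X′ = inj₂ (below-slope-step-back X′ Y 3b≤X′ Yb≤aX)

  AboveSlope : ℕ → ℕ → Set
  AboveSlope X Y = Y ≤ X × a ℕ.* X ≤ b ℕ.* Y

  above-slope-step-back-by-ba : ∀ X′ Y′ → Y′ ℕ.+ a ℕ.+ b ≤ X′ ℕ.+ b ℕ.+ a →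
                                a ℕ.* (X′ ℕ.+ b) ≤ b ℕ.* (Y′ ℕ.+ a) →
                                StepBack a b AboveSlope ℕ._+_ (a ℕ.+ b) (X′ ℕ.+ b) (Y′ ℕ.+ a)
  above-slope-step-back-by-ba X′ Y′ Y+b≤X+a aX≤bY = record
    { X′ = X′ ; Y′ = Y′
    ; invariant = Y′≤X′ , above-slope-shift a≤b X′ Y′ aX≤bY
    ; potential = ℕ-solve (X′ ∷ Y′ ∷ a ∷ b ∷ [])
    ; extend = λ p → step p k2
    }
    where
    open ℕP.≤-Reasoning
    Y′≤X′ : Y′ ≤ X′
    Y′≤X′ = ℕP.+-cancelʳ-≤ (a ℕ.+ b) Y′ X′ (begin
      Y′ ℕ.+ (a ℕ.+ b)   ≡⟨ ℕP.+-assoc Y′ a b ⟨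
      Y′ ℕ.+ a ℕ.+ b     ≤⟨ Y+b≤X+a ⟩
      X′ ℕ.+ b ℕ.+ a     ≡⟨ ℕ-solve (X′ ∷ a ∷ b ∷ []) ⟩
      X′ ℕ.+ (a ℕ.+ b)   ∎)

  above-slope-step-back-by-ab : ∀ X′ Y′ → 4 ℕ.* b ≤ X′ ℕ.+ a → X′ ℕ.+ a ℕ.+ a ≤ Y′ ℕ.+ b ℕ.+ b →
                                Y′ ℕ.+ b ≤ X′ ℕ.+ a →
                                StepBack a b AboveSlope ℕ._+_ (a ℕ.+ b) (X′ ℕ.+ a) (Y′ ℕ.+ b)
  above-slope-step-back-by-ab X′ Y′ 4b≤X X+a≤Y+b Y≤X = record
    { X′ = X′ ; Y′ = Y′
    ; invariant = Y′≤X′ , above-slope-cross a≤b X′ Y′ X+a≤Y+b 2a≤Y′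
    ; potential = ℕ-solve (X′ ∷ Y′ ∷ a ∷ b ∷ [])
    ; extend = λ p → step p k1
    }
    where
    open ℕP.≤-Reasoning
    Y′≤X′ : Y′ ≤ X′
    Y′≤X′ = ℕP.+-cancelʳ-≤ b Y′ X′ (ℕP.≤-trans Y≤X (ℕP.+-monoʳ-≤ X′ a≤b))
    2a≤Y′ : a ℕ.+ a ≤ Y′
    2a≤Y′ = ℕP.+-cancelʳ-≤ (b ℕ.+ b) (a ℕ.+ a) Y′ (begin
      a ℕ.+ a ℕ.+ (b ℕ.+ b)   ≤⟨ ℕP.+-monoˡ-≤ (b ℕ.+ b) (ℕP.+-mono-≤ a≤b a≤b) ⟩
      b ℕ.+ b ℕ.+ (b ℕ.+ b)   ≡⟨ ℕ-solve (b ∷ []) ⟩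
      4 ℕ.* b                 ≤⟨ 4b≤X ⟩
      X′ ℕ.+ a                ≤⟨ ℕP.m≤m+n (X′ ℕ.+ a) a ⟩
      X′ ℕ.+ a ℕ.+ a          ≤⟨ X+a≤Y+b ⟩
      Y′ ℕ.+ b ℕ.+ b          ≡⟨ ℕP.+-assoc Y′ b b ⟩
      Y′ ℕ.+ (b ℕ.+ b)        ∎)

  above-slope-stop-or-step : ∀ {X Y} → AboveSlope X Y →
    Within a b (42 ℕ.* b) (+ X) (+ Y) ⊎ StepBack a b AboveSlope ℕ._+_ (a ℕ.+ b) X Y
  above-slope-stop-or-step {X} {Y} (Y≤X , aX≤bY) with X ℕ.<? 4 ℕ.* b | Y ℕ.+ b ℕ.≤? X ℕ.+ a
  ... | yes X<4b | _ = inj₁ (box a≤b coprime a+b-odd X Y X<4b (ℕP.≤-<-trans Y≤X X<4b))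
  ... | no X≮4b | yes Y+b≤X+a
    with m≤n⇒∃[o]o+m≡n b≤X | m≤n⇒∃[o]o+m≡n (above-slope⇒a≤Y a≤b aX≤bY b≤X)
    where
    b≤X : b ≤ X
    b≤X = ℕP.≤-trans (ℕP.m≤m+n b (3 ℕ.* b)) (ℕP.≮⇒≥ X≮4b)
  ...   | X′ , refl | Y′ , refl = inj₂ (above-slope-step-back-by-ba X′ Y′ Y+b≤X+a aX≤bY)
  above-slope-stop-or-step {X} {Y} (Y≤X , aX≤bY) | no X≮4b | no Y+b≰X+a
    with m≤n⇒∃[o]o+m≡n a≤X
       | m≤n⇒∃[o]o+m≡n (above-slope⇒b≤Y a≤b (ℕP.≮⇒≥ X≮4b) (ℕP.≰⇒> Y+b≰X+a))
    where
    a≤X : a ≤ X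
    a≤X = ℕP.≤-trans a≤b (ℕP.≤-trans (ℕP.m≤m+n b (3 ℕ.* b)) (ℕP.≮⇒≥ X≮4b))
  ...   | X′ , refl | Y′ , refl =
    inj₂ (above-slope-step-back-by-ab X′ Y′ (ℕP.≮⇒≥ X≮4b) (ℕP.<⇒≤ (ℕP.≰⇒> Y+b≰X+a)) Y≤X)

-- Rational arithmetic

pos-*-≤ : ∀ m n p q → m ℕ.* n ≤ p ℕ.* q → + m ℤ.* + n ℤ.≤ + p ℤ.* + q
pos-*-≤ m n p q mn≤pq = subst₂ ℤ._≤_ (ℤP.pos-* m n) (ℤP.pos-* p q) (ℤ.+≤+ mn≤pq)

toℚᵘ-/ : ∀ i n .{{_ : NonZero n}} → toℚᵘ (i / n) ≃ᵘ i /ᵘ n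
toℚᵘ-/ i (suc n) = ℚP.toℚᵘ-fromℚᵘ (mkℚᵘ i n)

/-≤-/ : ∀ i j m n .{{_ : NonZero m}} .{{_ : NonZero n}} →
        (i / m ≤q j / n) ⇔ (i ℤ.* + n ℤ.≤ j ℤ.* + m)
/-≤-/ i j m@(suc _) n@(suc _) = mk⇔
  (λ le → ℚᵘP.drop-*≤* (ℚᵘP.≤-respʳ-≃ (toℚᵘ-/ j n)
                          (ℚᵘP.≤-respˡ-≃ (toℚᵘ-/ i m) (ℚP.toℚᵘ-mono-≤ le))))
  (λ le → ℚP.toℚᵘ-cancel-≤ (ℚᵘP.≤-respʳ-≃ (ℚᵘP.≃-sym (toℚᵘ-/ j n))
                              (ℚᵘP.≤-respˡ-≃ (ℚᵘP.≃-sym (toℚᵘ-/ i m)) (*≤* le))))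

/-*-/1 : ∀ i j m .{{_ : NonZero m}} → (i / m) * (j / 1) ≡ (i ℤ.* j) / m
/-*-/1 i j m@(suc m-1) = ℚP.toℚᵘ-injective (begin
  toℚᵘ ((i / m) * (j / 1))         ≈⟨ ℚP.toℚᵘ-homo-* (i / m) (j / 1) ⟩
  toℚᵘ (i / m) ℚᵘ.* toℚᵘ (j / 1)   ≈⟨ ℚᵘP.*-cong (toℚᵘ-/ i m) (toℚᵘ-/ j 1) ⟩
  (i /ᵘ m) ℚᵘ.* (j /ᵘ 1)           ≈⟨ *≡* (cong (λ k → i ℤ.* j ℤ.* + suc k) (sym (ℕP.*-identityʳ m-1))) ⟩
  (i ℤ.* j) /ᵘ m                   ≈⟨ toℚᵘ-/ (i ℤ.* j) m ⟨
  toℚᵘ ((i ℤ.* j) / m)             ∎)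
  where open ℚᵘP.≃-Reasoning

/1-/ : ∀ i j m .{{_ : NonZero m}} → (i / 1) - (j / m) ≡ (i ℤ.* + m ℤ.- j) / m
/1-/ i j m@(suc m-1) = ℚP.toℚᵘ-injective (begin
  toℚᵘ (i / 1 - j / m)                   ≈⟨ ℚP.toℚᵘ-homo-+ (i / 1) (ℚ.- (j / m)) ⟩
  toℚᵘ (i / 1) ℚᵘ.+ toℚᵘ (ℚ.- (j / m))   ≈⟨ ℚᵘP.+-cong (toℚᵘ-/ i 1) toℚᵘ-[-j/m] ⟩
  (i /ᵘ 1) ℚᵘ.- (j /ᵘ m)                 ≈⟨ *≡* cross-multiplied ⟩
  (i ℤ.* + m ℤ.- j) /ᵘ m                 ≈⟨ toℚᵘ-/ (i ℤ.* + m ℤ.- j) m ⟨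
  toℚᵘ ((i ℤ.* + m ℤ.- j) / m)           ∎)
  where
  open ℚᵘP.≃-Reasoning
  toℚᵘ-[-j/m] : toℚᵘ (ℚ.- (j / m)) ≃ᵘ ℚᵘ.- (j /ᵘ m)
  toℚᵘ-[-j/m] = ℚᵘP.≃-trans (ℚP.toℚᵘ-homo‿- (j / m)) (ℚᵘP.-‿cong (toℚᵘ-/ j m))
  cross-multiply : ∀ i j M → (i ℤ.* M ℤ.+ - j ℤ.* + 1) ℤ.* M ≡ (i ℤ.* M ℤ.- j) ℤ.* M
  cross-multiply = solve-∀
  cross-multiplied : (i ℤ.* + m ℤ.+ - j ℤ.* + 1) ℤ.* + m ≡ (i ℤ.* + m ℤ.- j) ℤ.* + suc (m-1 ℕ.+ 0)
  cross-multiplied = trans (cross-multiply i j (+ m))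
    (cong (λ k → (i ℤ.* + m ℤ.- j) ℤ.* + suc k) (sym (ℕP.+-identityʳ m-1)))

n/1*m/1≡nm/1 : ∀ n m → (+ n / 1) * (+ m / 1) ≡ + (n ℕ.* m) / 1
n/1*m/1≡nm/1 n m = trans (/-*-/1 (+ n) (+ m) 1) (cong (_/ 1) (sym (ℤP.pos-* n m)))

∣n-x/d∣≤K : ∀ n x d K .{{_ : NonZero d}} → x ≤ n ℕ.* d → n ℕ.* d ≤ x ℕ.+ K ℕ.* d →
            ∣ + n / 1 - + x / d ∣ ≤q + K / 1
∣n-x/d∣≤K n x d K x≤nd nd≤x+Kd with m≤n⇒∃[o]o+m≡n x≤nd
... | w , w+x≡nd = begin
  ∣ + n / 1 - + x / d ∣           ≡⟨ cong ∣_∣ (/1-/ (+ n) (+ x) d) ⟩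
  ∣ (+ n ℤ.* + d ℤ.- + x) / d ∣   ≡⟨ cong (λ z → ∣ z / d ∣) nd-x≡w ⟩
  ∣ + w / d ∣                     ≡⟨ ℚP.0≤p⇒∣p∣≡p 0≤w/d ⟩
  + w / d                         ≤⟨ w/d≤K ⟩
  + K / 1                         ∎
  where
  open ℚP.≤-Reasoning
  nd-x≡w : + n ℤ.* + d ℤ.- + x ≡ + w
  nd-x≡w = trans (cong (ℤ._- + x) (trans (sym (ℤP.pos-* n d)) (cong +_ (sym w+x≡nd))))
                 (//-rightDividesʳ (+ x) (+ w))
  w≤Kd : w ≤ K ℕ.* d
  w≤Kd = ℕP.+-cancelˡ-≤ x w (K ℕ.* d)
           (subst (_≤ x ℕ.+ K ℕ.* d) (trans (sym w+x≡nd) (ℕP.+-comm w x)) nd≤x+Kd)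
  0≤w/d : 0ℚ ≤q + w / d
  0≤w/d = Equivalence.from (/-≤-/ (+ 0) (+ w) 1 d) (pos-*-≤ 0 d w 1 z≤n)
  w/d≤K : + w / d ≤q + K / 1
  w/d≤K = Equivalence.from (/-≤-/ (+ w) (+ K) d 1)
            (pos-*-≤ w 1 K d (subst (_≤ K ℕ.* d) (sym (ℕP.*-identityʳ w)) w≤Kd))

below-slope⇔ : ∀ a b x y .{{_ : NonZero b}} →
               (+ y / 1 ≤q (+ a / b) * (+ x / 1)) ⇔ (y ℕ.* b ≤ a ℕ.* x)
below-slope⇔ a b x y = mk⇔
  (λ le → ℤP.drop‿+≤+ (subst₂ ℤ._≤_ (sym (ℤP.pos-* y b)) ax*1≡ax
            (Equivalence.to cross (subst (+ y / 1 ≤q_) (/-*-/1 (+ a) (+ x) b) le))))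
  (λ le → subst (+ y / 1 ≤q_) (sym (/-*-/1 (+ a) (+ x) b))
            (Equivalence.from cross (subst₂ ℤ._≤_ (ℤP.pos-* y b) (sym ax*1≡ax) (ℤ.+≤+ le))))
  where
  cross : (+ y / 1 ≤q (+ a ℤ.* + x) / b) ⇔ (+ y ℤ.* + b ℤ.≤ + a ℤ.* + x ℤ.* + 1)
  cross = /-≤-/ (+ y) (+ a ℤ.* + x) 1 b
  ax*1≡ax : + a ℤ.* + x ℤ.* + 1 ≡ + (a ℕ.* x)
  ax*1≡ax = trans (ℤP.*-identityʳ (+ a ℤ.* + x)) (sym (ℤP.pos-* a x))

minimal : ∀ {P : ℕ → Set} → Decidable P → ∀ {n} → P n → ∃ λ m → P m × (∀ k → k < m → ¬ P k)
minimal P? {n} Pn with P? 0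
... | yes P0 = 0 , P0 , λ _ ()
minimal P? {zero}  P0 | no ¬P0 = contradiction P0 ¬P0
minimal P? {suc n} Pn | no ¬P0 with minimal (P? ∘ suc) Pn
... | m , Pm , below = suc m , Pm , λ { zero _ → ¬P0 ; (suc k) (s≤s k<m) → below k k<m }

knightDist-within : ∀ {a b X Y n₀} v w K .{{_ : NonZero w}} →
  (∀ {n} → InSumset a b n (+ X) (+ Y) → v ≤ n ℕ.* w) →
  InSumset a b n₀ (+ X) (+ Y) → n₀ ℕ.* w ≤ v ℕ.+ K ℕ.* w →
  ∃ λ n → KnightDist a b (+ X) (+ Y) n × ∣ + n / 1 - + v / w ∣ ≤q + K / 1
knightDist-within {a} {b} {X} {Y} {n₀} v w K lower p n₀w≤v+Kw
  with minimal (λ m → inSumset? m (+ X) (+ Y)) p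
... | n , pn , below =
  n , (pn , below) , ∣n-x/d∣≤K n v w K (lower pn) (ℕP.≤-trans (ℕP.*-monoˡ-≤ w n≤n₀) n₀w≤v+Kw)
  where
  n≤n₀ : n ≤ n₀
  n≤n₀ = ℕP.≮⇒≥ (λ n₀<n → below n₀ n₀<n p)

module _ {a b : ℕ} .{{_ : NonZero b}} .{{_ : NonZero (a ℕ.+ b)}}
         (a≤b : a ≤ b) (coprime : Coprime a b) (a+b-odd : ¬ 2 ∣ a ℕ.+ b) where

  Estimate : ℤ → ℤ → Set
  Estimate x y = ∃ λ n → KnightDist a b x y n ×
    ((y / 1 ≤q (+ a / b) * (x / 1) →
        ∣ + n / 1 - x / b ∣ ≤q + 42 / 1 * (+ b / 1)) ×
     (¬ (y / 1 ≤q (+ a / b) * (x / 1)) →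
        ∣ + n / 1 - (x ℤ.+ y) / (a ℕ.+ b) ∣ ≤q + 42 / 1 * (+ b / 1)))

  -- The case split is a helper, not a with: with-abstraction normalises the goal, and normalising
  -- its rational literals exhausts memory.
  knight-distance-estimate : ∀ x y → + 0 ℤ.≤ y → y ℤ.≤ x → Estimate x y
  knight-distance-estimate _ _ (ℤ.+≤+ _) (ℤ.+≤+ {Y} {X} Y≤X) = by-slope (Y ℕ.* b ℕ.≤? a ℕ.* X)
    where
    by-slope : Dec (Y ℕ.* b ≤ a ℕ.* X) → Estimate (+ X) (+ Y)
    by-slope (yes Yb≤aX) =
      let n₀ , p , n₀b≤X+42bb = descend (42 ℕ.* b) b (BelowSlope a≤b coprime a+b-odd) (λ X _ → X)
                                  (below-slope-stop-or-step a≤b coprime a+b-odd) X Y Yb≤aX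
          n , dist , close = knightDist-within X b (42 ℕ.* b)
                               (ℤP.drop‿+≤+ ∘ sumset-x≤n*b a≤b) p n₀b≤X+42bb
      in n , dist , (λ _ → subst (∣ + n / 1 - + X / b ∣ ≤q_) (sym (n/1*m/1≡nm/1 42 b)) close) ,
         (λ ¬below → contradiction (Equivalence.from (below-slope⇔ a b X Y) Yb≤aX) ¬below)
    by-slope (no Yb≰aX) =
      let aX≤bY = ℕP.≤-trans (ℕP.<⇒≤ (ℕP.≰⇒> Yb≰aX)) (ℕP.≤-reflexive (ℕP.*-comm Y b))
          n₀ , p , n₀w≤X+Y+42bw = descend (42 ℕ.* b) (a ℕ.+ b) (AboveSlope a≤b coprime a+b-odd) ℕ._+_
                                    (above-slope-stop-or-step a≤b coprime a+b-odd) X Y (Y≤X , aX≤bY)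
          n , dist , close = knightDist-within (X ℕ.+ Y) (a ℕ.+ b) (42 ℕ.* b)
                               (ℤP.drop‿+≤+ ∘ sumset-x+y≤n*[a+b] a≤b) p n₀w≤X+Y+42bw
      in n , dist , (λ below → contradiction (Equivalence.to (below-slope⇔ a b X Y) below) Yb≰aX) ,
         (λ _ → subst (∣ + n / 1 - + (X ℕ.+ Y) / (a ℕ.+ b) ∣ ≤q_) (sym (n/1*m/1≡nm/1 42 b)) close)

theorem1p1 : Σ ℚ λ C → 0ℚ <q C ×
    (∀ (a b : ℕ) → .{{_ : NonZero b}} → .{{_ : NonZero (a + b)}} →
      1 ≤ a → a < b → Coprime a b → ¬ (2 ∣ a + b) →
      ∀ (x y : ℤ) → + 0 Data.Integer.≤ y → y Data.Integer.≤ x →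
      ∃ λ n → KnightDist a b x y n ×
        ((y / 1 ≤q (+ a / b) * (x / 1) →
            ∣ (+ n / 1) - (x / b) ∣ ≤q C * (+ b / 1)) ×
         (¬ (y / 1 ≤q (+ a / b) * (x / 1)) →
            ∣ (+ n / 1) - ((x Data.Integer.+ y) / (a + b)) ∣ ≤q C * (+ b / 1))))
theorem1p1 = + 42 / 1 , ℚ.*<* (ℤ.+<+ (s≤s z≤n)) ,
  λ a b _ a<b coprime a+b-odd → knight-distance-estimate (ℕP.<⇒≤ a<b) coprime a+b-odd
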